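{- If $F_0,\dots,F_n,G_0,\dots,G_n$ are $n$PC formulas with $F_i\sim G_i$ for all $0\le i\le n$, then $q(F_0,\dots,F_n)\sim q(G_0,\dots,G_n)$.
   Context: Fix $n\ge 2$, write $\hat n=\{1,\dots,n\}$, let $S_n$ be the group of permutations of $\hat n$ and $V$ a countable set of propositional variables. Formulas of $n$PC are: decorated variables $X^\pi$ ($X\in V$, $\pi\in S_n$); constants $\mathsf e_1,\dots,\mathsf e_n$; compound formulas $q(F,G_1,\dots,G_n)$. For $\rho\in S_n$, $F^\rho$ is defined by $(X^\pi)^\rho=X^{\rho\circ\pi}$, $(\mathsf e_k)^\rho=\mathsf e_{\rho(k)}$, $q(F,G_1,\dots,G_n)^\rho=q(F,G_1^\rho,\dots,G_n^\rho)$. $(ij)$ denotes the transposition exchanging $i$ and $j$ (identity if $i=j$). Contexts $\Gamma,\Delta$ are finite multisets of formulas, $\Gamma^\rho$ elementwise. Sequents $\Gamma\vdash_i\Delta$ ($i\in\hat n$) are provable if derivable by the rules (premises $\Rightarrow$ conclusion), for all $i,j,k\in\hat n$: (Const) $\Rightarrow\ \vdash_i\mathsf e_i$. (Id) $\Rightarrow X^\pi\vdash_i X^\rho$ whenever $\pi^{ -1}(i)=\rho^{ -1}(i)$. (Sym) $\Gamma^{(ij)}\vdash_i\Delta^{(ij)}\Rightarrow\Gamma\vdash_j\Delta$. (Neg1) if $i\ne k$: $\Gamma^{(ij)}\vdash_i F,\Delta^{(ij)}\Rightarrow \Gamma,F^{(jk)}\vdash_j\Delta$. (Neg2) if $j\neq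 k$: $\Gamma^{(ij)}\vdash_i F,\Delta^{(ij)}\Rightarrow \Gamma,F^{(ik)}\vdash_j\Delta$. (Neg3) $\{\Gamma^{(ij)},F\vdash_i\Delta^{(ij)}\}_{i\neq j}\Rightarrow\Gamma\vdash_j F,\Delta$. (qL) $\{\Gamma^{(ji)},F,G_j^{(ji)}\vdash_j\Delta^{(ji)}\}_{j\in\hat n}\Rightarrow \Gamma,q(F,G_1,\dots,G_n)\vdash_i\Delta$. (qR) $\{\Gamma^{(ji)},F\vdash_j G_j^{(ji)},\Delta^{(ji)}\}_{j\in\hat n}\Rightarrow\Gamma\vdash_i q(F,G_1,\dots,G_n),\Delta$. (Cut) $\Gamma,F\vdash_i\Delta$ and $\Gamma\vdash_i F,\Delta\Rightarrow\Gamma\vdash_i\Delta$. Left and right weakening and contraction in each $\vdash_i$. $F\sim G$ means: for every $i\in\hat n$, both $F\vdash_i G$ and $G\vdash_i F$ are provable. -}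

module Defs where

open import Data.Nat using (ℕ)
open import Data.Fin using (Fin)
open import Data.Fin.Permutation using (Permutation′; _⟨$⟩ʳ_; _⟨$⟩ˡ_; _∘ₚ_; transpose)
open import Data.List using (List; []; _∷_; map)
open import Data.Product using (_×_)
open import Relation.Binary.PropositionalEquality using (_≡_; _≢_)

Var : Set
Var = ℕ

-- Formulas of nPC (for a fixed n).  Permutations π ∈ S_n are stdlib
-- bijections Fin n ↔ Fin n.
data Formula (n : ℕ) : Set where
  var : Var → Permutation′ n → Formula n
  con : Fin n → Formula n
  q   : Formula n → (Fin n → Formula n) → Formula n

-- Composition in the usual (right-to-left) order: (ρ ∘ π)(x) = ρ(π(x)).
_∘ₛ_ : ∀ {n} → Permutation′ n → Permutation′ n → Permutation′ n
ρ ∘ₛ π = π ∘ₚ ρ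

tr : ∀ {n} → Fin n → Fin n → Permutation′ n
tr i j = transpose i j

_^_ : ∀ {n} → Formula n → Permutation′ n → Formula n
var X π ^ ρ = var X (ρ ∘ₛ π)
con k ^ ρ = con (ρ ⟨$⟩ʳ k)
q F G ^ ρ = q F (λ k → G k ^ ρ)

-- Equality of formulas: syntactic identity, where two decorations are
-- identified when they are the same element of S_n (i.e. pointwise equal
-- as functions) and the argument families of q are compared pointwise.
data _≈F_ {n : ℕ} : Formula n → Formula n → Set where
  var≈ : ∀ {X π ρ} → (∀ x → π ⟨$⟩ʳ x ≡ ρ ⟨$⟩ʳ x) → var X π ≈F var X ρ
  con≈ : ∀ {k} → con k ≈F con k
  q≈   : ∀ {F F′ G G′} → F ≈F F′ → (∀ k → G k ≈F G′ k) → q F G ≈F q F′ G′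

-- Contexts: finite multisets of formulas, represented as lists up to
-- reordering (and up to the above equality of formulas).
Ctx : ℕ → Set
Ctx n = List (Formula n)

data _≋_ {n : ℕ} : Ctx n → Ctx n → Set where
  []≋   : [] ≋ []
  cons≋ : ∀ {x y xs ys} → x ≈F y → xs ≋ ys → (x ∷ xs) ≋ (y ∷ ys)
  swap≋ : ∀ {x y xs} → (x ∷ y ∷ xs) ≋ (y ∷ x ∷ xs)
  trans≋ : ∀ {xs ys zs} → xs ≋ ys → ys ≋ zs → xs ≋ zs

_^ᶜ_ : ∀ {n} → Ctx n → Permutation′ n → Ctx n
Γ ^ᶜ ρ = map (_^ ρ) Γ

-- Provability of sequents Γ ⊢_i Δ.  "Γ, F" is written F ∷ Γ.
data _⊢[_]_ {n : ℕ} : Ctx n → Fin n → Ctx n → Set where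
  const : ∀ {i} → [] ⊢[ i ] (con i ∷ [])
  ident : ∀ {i X π ρ} → π ⟨$⟩ˡ i ≡ ρ ⟨$⟩ˡ i →
          (var X π ∷ []) ⊢[ i ] (var X ρ ∷ [])
  sym   : ∀ {i j Γ Δ} → (Γ ^ᶜ tr i j) ⊢[ i ] (Δ ^ᶜ tr i j) → Γ ⊢[ j ] Δ
  neg1  : ∀ {i j k Γ Δ F} → i ≢ k →
          (Γ ^ᶜ tr i j) ⊢[ i ] (F ∷ (Δ ^ᶜ tr i j)) →
          ((F ^ tr j k) ∷ Γ) ⊢[ j ] Δ
  neg2  : ∀ {i j k Γ Δ F} → j ≢ k →
          (Γ ^ᶜ tr i j) ⊢[ i ] (F ∷ (Δ ^ᶜ tr i j)) →
          ((F ^ tr i k) ∷ Γ) ⊢[ j ] Δ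
  neg3  : ∀ {j Γ Δ F} →
          (∀ i → i ≢ j → (F ∷ (Γ ^ᶜ tr i j)) ⊢[ i ] (Δ ^ᶜ tr i j)) →
          Γ ⊢[ j ] (F ∷ Δ)
  qL    : ∀ {i Γ Δ F G} →
          (∀ j → ((G j ^ tr j i) ∷ F ∷ (Γ ^ᶜ tr j i)) ⊢[ j ] (Δ ^ᶜ tr j i)) →
          (q F G ∷ Γ) ⊢[ i ] Δ
  qR    : ∀ {i Γ Δ F G} →
          (∀ j → (F ∷ (Γ ^ᶜ tr j i)) ⊢[ j ] ((G j ^ tr j i) ∷ (Δ ^ᶜ tr j i))) →
          Γ ⊢[ i ] (q F G ∷ Δ)
  cut   : ∀ {i Γ Δ F} → (F ∷ Γ) ⊢[ i ] Δ → Γ ⊢[ i ] (F ∷ Δ) → Γ ⊢[ i ] Δ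
  weakL : ∀ {i Γ Δ F} → Γ ⊢[ i ] Δ → (F ∷ Γ) ⊢[ i ] Δ
  weakR : ∀ {i Γ Δ F} → Γ ⊢[ i ] Δ → Γ ⊢[ i ] (F ∷ Δ)
  contrL : ∀ {i Γ Δ F} → (F ∷ F ∷ Γ) ⊢[ i ] Δ → (F ∷ Γ) ⊢[ i ] Δ
  contrR : ∀ {i Γ Δ F} → Γ ⊢[ i ] (F ∷ F ∷ Δ) → Γ ⊢[ i ] (F ∷ Δ)
  -- contexts are multisets: sequents are invariant under ≋
  exch  : ∀ {i Γ Γ′ Δ Δ′} → Γ ≋ Γ′ → Δ ≋ Δ′ → Γ ⊢[ i ] Δ → Γ′ ⊢[ i ] Δ′

_∼_ : ∀ {n} → Formula n → Formula n → Set
F ∼ G = ∀ i → ((F ∷ []) ⊢[ i ] (G ∷ [])) × ((G ∷ []) ⊢[ i ] (F ∷ []))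

-- Right-introduce q(G₀, G) and then left-introduce q(F₀, F): this leaves, for
-- every pair (j, l), a sequent at index l.  On the diagonal l = j the
-- transposition (lj) is trivial and the sequent is a relabelled instance of
-- F_l ⊢ G_l.  Off the diagonal, Neg2 (with i = j) turns F₀ ⊢_l G₀ into
-- G₀^(lj), F₀ ⊢_l, i.e. the two hypotheses F₀ and G₀^(lj) are contradictory.
module Submission where

open import Defs
open import Data.Nat using (ℕ; _≤_)
open import Data.Fin using (Fin; _≟_)
open import Data.Fin.Permutation using (Permutation′; _⟨$⟩ʳ_)
import Data.Fin.Permutation.Components as PC
open import Data.List using ([]; _∷_)
open import Data.Product using (_,_; proj₁; proj₂)
open import Relation.Nullary using (yes; no)
open import Relation.Binary.PropositionalEquality using (_≡_; _≢_; refl) renaming (sym to ≡-sym)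

≈F-refl : ∀ {n} (F : Formula n) → F ≈F F
≈F-refl (var X π) = var≈ (λ _ → refl)
≈F-refl (con k)   = con≈
≈F-refl (q F G)   = q≈ (≈F-refl F) (λ k → ≈F-refl (G k))

≈F-sym : ∀ {n} {F G : Formula n} → F ≈F G → G ≈F F
≈F-sym (var≈ e)   = var≈ (λ x → ≡-sym (e x))
≈F-sym con≈       = con≈
≈F-sym (q≈ e₀ e)  = q≈ (≈F-sym e₀) (λ k → ≈F-sym (e k))

≋-refl : ∀ {n} (Γ : Ctx n) → Γ ≋ Γ
≋-refl []      = []≋
≋-refl (F ∷ Γ) = cons≋ (≈F-refl F) (≋-refl Γ)

≋-sym : ∀ {n} {Γ Δ : Ctx n} → Γ ≋ Δ → Δ ≋ Γ
≋-sym []≋            = []≋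
≋-sym (cons≋ e es)   = cons≋ (≈F-sym e) (≋-sym es)
≋-sym swap≋          = swap≋
≋-sym (trans≋ es ds) = trans≋ (≋-sym ds) (≋-sym es)

≋-reverse₃ : ∀ {n} {A B C : Formula n} → (A ∷ B ∷ C ∷ []) ≋ (C ∷ B ∷ A ∷ [])
≋-reverse₃ = trans≋ swap≋ (trans≋ (cons≋ (≈F-refl _) swap≋) swap≋)

con-cong : ∀ {n} {k l : Fin n} → k ≡ l → con k ≈F con l
con-cong refl = con≈

^-identity : ∀ {n} {ρ : Permutation′ n} → (∀ x → ρ ⟨$⟩ʳ x ≡ x) →
             (F : Formula n) → (F ^ ρ) ≈F F
^-identity e (var X π) = var≈ (λ x → e (π ⟨$⟩ʳ x))
^-identity e (con k)   = con-cong (e k)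
^-identity e (q F G)   = q≈ (≈F-refl F) (λ k → ^-identity e (G k))

^-inverse : ∀ {n} {σ ρ : Permutation′ n} → (∀ x → ρ ⟨$⟩ʳ (σ ⟨$⟩ʳ x) ≡ x) →
            (F : Formula n) → ((F ^ σ) ^ ρ) ≈F F
^-inverse e (var X π) = var≈ (λ x → e (π ⟨$⟩ʳ x))
^-inverse e (con k)   = con-cong (e k)
^-inverse e (q F G)   = q≈ (≈F-refl F) (λ k → ^-inverse e (G k))

^ᶜ-identity : ∀ {n} {ρ : Permutation′ n} → (∀ x → ρ ⟨$⟩ʳ x ≡ x) →
              (Γ : Ctx n) → (Γ ^ᶜ ρ) ≋ Γ
^ᶜ-identity e []      = []≋
^ᶜ-identity e (F ∷ Γ) = cons≋ (^-identity e F) (^ᶜ-identity e Γ)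

^ᶜ-inverse : ∀ {n} {σ ρ : Permutation′ n} → (∀ x → ρ ⟨$⟩ʳ (σ ⟨$⟩ʳ x) ≡ x) →
             (Γ : Ctx n) → ((Γ ^ᶜ σ) ^ᶜ ρ) ≋ Γ
^ᶜ-inverse e []      = []≋
^ᶜ-inverse e (F ∷ Γ) = cons≋ (^-inverse e F) (^ᶜ-inverse e Γ)

tr-self : ∀ {n} (i k : Fin n) → tr i i ⟨$⟩ʳ k ≡ k
tr-self i k with k ≟ i
... | yes k≡i = ≡-sym k≡i
... | no _ with k ≟ i
...   | yes k≡i = ≡-sym k≡i
...   | no _    = refl

tr-involutive : ∀ {n} (i j k : Fin n) → tr i j ⟨$⟩ʳ (tr j i ⟨$⟩ʳ k) ≡ k
tr-involutive i j k = PC.transpose-inverse i j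

⊢-transpose : ∀ {n} {i j : Fin n} {Γ Δ : Ctx n} → Γ ⊢[ i ] Δ →
              (Γ ^ᶜ tr j i) ⊢[ j ] (Δ ^ᶜ tr j i)
⊢-transpose {i = i} {j} {Γ} {Δ} ⊢Δ =
  sym (exch (≋-sym (^ᶜ-inverse (tr-involutive i j) Γ))
            (≋-sym (^ᶜ-inverse (tr-involutive i j) Δ)) ⊢Δ)

neg2-diagonal : ∀ {n} {l k : Fin n} {Γ Δ : Ctx n} {F : Formula n} → l ≢ k →
                Γ ⊢[ l ] (F ∷ Δ) → ((F ^ tr l k) ∷ Γ) ⊢[ l ] Δ
neg2-diagonal {l = l} {Γ = Γ} {Δ} {F} l≢k ⊢FΔ =
  neg2 l≢k (exch (≋-sym (^ᶜ-identity (tr-self l) Γ))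
                 (cons≋ (≈F-refl F) (≋-sym (^ᶜ-identity (tr-self l) Δ))) ⊢FΔ)

q-monotone : ∀ {n} {F₀ G₀ : Formula n} {F G : Fin n → Formula n} →
             (∀ m → (F₀ ∷ []) ⊢[ m ] (G₀ ∷ [])) →
             (∀ k m → (F k ∷ []) ⊢[ m ] (G k ∷ [])) →
             ∀ i → (q F₀ F ∷ []) ⊢[ i ] (q G₀ G ∷ [])
q-monotone {F₀ = F₀} {G₀} {F} {G} F₀⊢G₀ F⊢G i =
  qR (λ j → exch swap≋ (≋-refl _) (qL (branch j)))
  where
  branch : ∀ j l → (((F l ^ tr j i) ^ tr l j) ∷ F₀ ∷ (G₀ ^ tr l j) ∷ [])
                     ⊢[ l ] (((G j ^ tr j i) ^ tr l j) ∷ [])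
  branch j l with l ≟ j
  ... | yes refl =
    exch (trans≋ ≋-reverse₃
                 (cons≋ (≈F-sym (^-identity (tr-self l) _)) (≋-refl _)))
         (cons≋ (≈F-sym (^-identity (tr-self l) _)) []≋)
         (weakL (weakL (⊢-transpose {j = l} (F⊢G l i))))
  ... | no l≢j =
    exch (cons≋ (≈F-refl _) swap≋) (≋-refl _)
         (weakL (weakR (neg2-diagonal l≢j (F₀⊢G₀ l))))

lemma4p3 : (n : ℕ) → 2 ≤ n → (F₀ G₀ : Formula n) (F G : Fin n → Formula n) →
           F₀ ∼ G₀ → (∀ k → F k ∼ G k) → q F₀ F ∼ q G₀ G
lemma4p3 n _ F₀ G₀ F G F₀∼G₀ F∼G i =
  q-monotone (λ m → proj₁ (F₀∼G₀ m)) (λ k m → proj₁ (F∼G k m)) i ,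
  q-monotone (λ m → proj₂ (F₀∼G₀ m)) (λ k m → proj₂ (F∼G k m)) i
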